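{- The number of chains in $\mathcal{WOC}(n)$ that do not contain the stopping condition $x_{i_1}\le x_{i_2}<x_{i_3}$ with $i_1<i_2<i_3$ (the active leaves) equals the number of Dyck paths of semilength $n$ in which each valley may be marked or not (i.e. $\sum_P 2^{v(P)}$ over Dyck paths $P$ of semilength $n$, $v(P)$ the number of valleys); in fact there is a bijection between these sets. These numbers are the little Schröder numbers $1,3,11,45,\dots$.
   Context: A weak-ordering chain on $x_1,\dots,x_n$ is an expression $x_{i_1}\,\mathrm{op}\,x_{i_2}\,\mathrm{op}\cdots\mathrm{op}\,x_{i_n}$, where $(i_1,\dots,i_n)$ is an ordering of $[n]$ and each $\mathrm{op}$ is $<$ or $=$; expressions defining the same ordered set partition of $[n]$ are identified. $\mathcal{WOC}(n)$ is the set of these chains. A chain contains the stopping condition $x_{i_1}\le x_{i_2}<x_{i_3}$ with $i_1<i_2<i_3$ if there are indices $i_1<i_2<i_3$ such that in the chain $x_{i_1}<x_{i_2}$ or $x_{i_1}=x_{i_2}$, and $x_{i_2}<x_{i_3}$. A Dyck path of semilength $n$ is a lattice path from $(0,0)$ to $(2n,0)$ with steps $\mathsf{U}=(1,1)$, $\mathsf{D}=(1,-1)$ never going below the $x$-axis; a valley is an occurrence of the subpath $\mathsf{DU}$. The little Schröder numbers are the sequence $1,3,11,45,197,\dots$ (OEIS A001003). -}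

module Defs where

open import Data.Nat using (ℕ; zero; suc; _*_; _≡ᵇ_; _/_)
open import Data.Bool using (Bool; true; false; T; not)
open import Data.Fin using (Fin; toℕ) renaming (_<_ to _<ᶠ_)
open import Data.Fin.Properties using (all?; any?)
open import Data.Nat as ℕ using (_≤_; _<_)
import Data.Nat.Properties as ℕP
import Data.Fin.Properties as FP
open import Data.Vec using (Vec; lookup)
open import Data.List using (List; []; _∷_; length; reverse; zipWith)
open import Data.Nat.ListAction using (sum)
open import Data.Product using (Σ; ∃; _×_; _,_)
open import Relation.Nullary using (Dec; ¬_)
open import Relation.Nullary.Decidable using (⌊_⌋; _×-dec_)
open import Relation.Binary.PropositionalEquality using (_≡_)

-- A chain in WOC(n) (an ordered set partition of [n], i.e. a chain up to
-- the identification of expressions defining the same ordered set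
-- partition) is represented canonically by its number k of blocks and
-- the rank function r : [n] → {0,…,k-1} (a Vec (Fin k) n), which must be
-- surjective.  In the chain, x_i < x_j iff r i < r j and x_i = x_j iff
-- r i = r j.  (Variables x_1..x_n are indexed by Fin n = {0..n-1}.)

Surjective : ∀ {n k} → Vec (Fin k) n → Set
Surjective {n} {k} r = ∀ (j : Fin k) → ∃ λ (i : Fin n) → lookup r i ≡ j

surjective? : ∀ {n k} (r : Vec (Fin k) n) → Dec (Surjective r)
surjective? r = all? λ j → any? λ i → lookup r i FP.≟ j

WOC : ℕ → Set
WOC n = Σ ℕ λ k → Σ (Vec (Fin k) n) λ r → T ⌊ surjective? r ⌋

ContainsStop : ∀ {n k} → Vec (Fin k) n → Set
ContainsStop {n} r =
  ∃ λ (i₁ : Fin n) → ∃ λ (i₂ : Fin n) → ∃ λ (i₃ : Fin n) →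
    (i₁ <ᶠ i₂) × (i₂ <ᶠ i₃) ×
    (toℕ (lookup r i₁) ≤ toℕ (lookup r i₂)) × (toℕ (lookup r i₂) < toℕ (lookup r i₃))

containsStop? : ∀ {n k} (r : Vec (Fin k) n) → Dec (ContainsStop r)
containsStop? r =
  any? λ i₁ → any? λ i₂ → any? λ i₃ →
    (i₁ FP.<? i₂) ×-dec (i₂ FP.<? i₃) ×-dec
    (toℕ (lookup r i₁) ℕP.≤? toℕ (lookup r i₂)) ×-dec
    (toℕ (lookup r i₂) ℕP.<? toℕ (lookup r i₃))

Active : ℕ → Set
Active n = Σ ℕ λ k → Σ (Vec (Fin k) n) λ r →
  T ⌊ surjective? r ⌋ × T (not ⌊ containsStop? r ⌋)

data Step : Set where
  U D : Step

dyckFrom : ℕ → List Step → Bool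
dyckFrom zero    []      = true
dyckFrom (suc h) []      = false
dyckFrom h       (U ∷ s) = dyckFrom (suc h) s
dyckFrom zero    (D ∷ s) = false
dyckFrom (suc h) (D ∷ s) = dyckFrom h s

IsDyck : ℕ → List Step → Bool
IsDyck n s = dyckFrom 0 s Data.Bool.∧ (length s ≡ᵇ 2 * n)

valleys : List Step → ℕ
valleys []           = 0
valleys (D ∷ U ∷ s)  = suc (valleys (U ∷ s))
valleys (_ ∷ s)      = valleys s

MarkedDyck : ℕ → Set
MarkedDyck n = Σ (List Step) λ P → T (IsDyck n P) × Vec Bool (valleys P)

-- Little Schröder numbers (OEIS A001003: 1, 1, 3, 11, 45, 197, …),
-- via the large Schröder numbers (A006318: 1, 2, 6, 22, 90, …),
-- S(0) = 1, S(m+1) = S(m) + Σ_{k=0}^{m} S(k) S(m-k),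
-- and s(0) = 1, s(m) = S(m)/2 for m ≥ 1.

-- schroederTable m = [S(m), S(m-1), …, S(0)]
schroederTable : ℕ → List ℕ
schroederTable zero    = 1 ∷ []
schroederTable (suc m) = (head0 t Data.Nat.+ sum (zipWith _*_ t (reverse t))) ∷ t
  where
  t = schroederTable m
  head0 : List ℕ → ℕ
  head0 []      = 0
  head0 (x ∷ _) = x

largeSchroeder : ℕ → ℕ
largeSchroeder n with schroederTable n
... | []    = 0
... | x ∷ _ = x

littleSchroeder : ℕ → ℕ
littleSchroeder zero    = 1
littleSchroeder (suc m) = largeSchroeder (suc m) / 2

{-# OPTIONS --safe #-}
-- A chain of WOC(n) with k blocks is its rank word w ∈ {0,…,k−1}ⁿ, a surjection onto the blocks.  It
-- avoids the stopping condition iff every letter is at least the threshold of the suffix after it: the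
-- least letter that starts no pattern y ≤ w_b < w_c (b < c) in that suffix.  Deleting the first letter x
-- leaves an active word (after closing the gap if x was alone in its block), and the admissible first
-- letters of a word of label d = k − threshold give it one child of label d + 1 and two children of each
-- label d, d − 1, …, 1: the Schröder generating tree.  Plane forests whose internal vertices carry a mark,
-- counted by vertices and labelled by their number of trees, grow by the same rule (delete the first
-- tree; unless it is a leaf, its mark and its number of children beyond the first say how to graft it
-- back), so the two families are isomorphic level by level.  Marked forests are counted by the little
-- Schröder numbers through the convolution s(m+1) = Σᵢ S(m−i)·s(i) with S(m+1) = 2·s(m+1), and they are
-- the Dyck paths with marked valleys: coding a vertex by one up-step per child followed by a down-step
-- and the code of each child, valleys are exactly the down-steps that enter internal vertices.
module Submission where

open import Defs
open import Data.Nat using (ℕ; zero; suc; pred; _+_; _*_; _∸_; _/_; _≤_; _<_; _≤?_; _<?_; _≟_; z≤n; s≤s; s≤s⁻¹)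
open import Data.Nat.Properties
open import Data.Nat.DivMod using (m*n/n≡m)
open import Data.Nat.Induction using (<-rec)
open import Data.Nat.ListAction as List using ()
open import Data.Nat.Tactic.RingSolver using (solve-∀)
open import Data.Bool using (Bool; true; false; T; if_then_else_)
open import Data.Bool.Properties using (T-irrelevant; T-≡; T-∧)
open import Data.Unit using (⊤; tt)
open import Data.Empty using (⊥-elim)
open import Data.Fin using (Fin; toℕ; fromℕ<) renaming (zero to fzero; suc to fsuc)
open import Data.Fin.Properties using (toℕ<n; toℕ-fromℕ<; fromℕ<-toℕ; toℕ-injective; +↔⊎; *↔×; 2↔Bool; 1↔⊤)
open import Data.List using (List; []; _∷_; _++_; length; replicate; take; drop; reverse; zipWith; applyDownFrom; applyUpTo)
open import Data.List.Properties
  using ( ++-assoc; ∷-injectiveʳ; length-++; length-++-≤ˡ; length-replicate; length-drop; length-take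
        ; take++drop≡id; reverse-applyDownFrom)
open import Data.Vec using (Vec; []; _∷_; map; lookup) renaming (_++_ to _++ᵛ_; take to takeᵛ; drop to dropᵛ)
open import Data.Vec.Properties using (lookup-map; ++-injective) renaming (take++drop≡id to take++drop≡idᵛ)
open import Data.Product using (Σ; _×_; _,_; proj₁; proj₂; map₁; uncurry)
open import Data.Product.Properties using (Σ-≡,≡→≡)
open import Data.Sum using (_⊎_; inj₁; inj₂)
open import Data.Product.Function.Dependent.Propositional using (Σ-↔)
open import Data.Product.Function.NonDependent.Propositional using (_×-↔_)
open import Data.Sum.Function.Propositional using (_⊎-↔_)
open import Function using (_∘_; _↔_; mk↔ₛ′; Inverse; _⇔_; mk⇔; Equivalence)
open import Function.Properties.Inverse using (↔-refl; ↔-sym; ↔-trans)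
open import Function.Related.Propositional using (module EquationalReasoning)
open import Algebra.Properties.Semiring.Sum +-*-semiring using (sum-syntax; sum⁺-syntax; sum-cong-≗; *-distribʳ-sum)
open import Relation.Nullary using (yes; no; ¬_; Irrelevant)
open import Relation.Nullary.Decidable using (⌊_⌋; toWitness; fromWitness; toWitnessFalse; fromWitnessFalse)
open import Relation.Binary.Definitions using (tri<; tri≈; tri>)
open import Relation.Binary.PropositionalEquality

private variable n k : ℕ

≡⇒↔ : ∀ {A B : Set} → A ≡ B → A ↔ B
≡⇒↔ refl = ↔-refl

mk↔-irrelevant : ∀ {A B : Set} → Irrelevant A → Irrelevant B → (A → B) → (B → A) → A ↔ B
mk↔-irrelevant A-irr B-irr f g = mk↔ₛ′ f g (λ _ → B-irr _ _) (λ _ → A-irr _ _)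

OfSize : {A : Set} → (A → ℕ) → ℕ → Set
OfSize {A} f n = Σ A λ x → f x ≡ n

OfSize-≡ : ∀ {A : Set} {f : A → ℕ} {n} {x y : A} {p : f x ≡ n} {q : f y ≡ n} →
           x ≡ y → _≡_ {A = OfSize f n} (x , p) (y , q)
OfSize-≡ {p = p} {q} refl = cong (_ ,_) (≡-irrelevant p q)

OfSize-↔ : ∀ {A B : Set} {f : A → ℕ} {g : B → ℕ} {n} (A↔B : A ↔ B) →
           (∀ x → g (Inverse.to A↔B x) ≡ f x) → OfSize f n ↔ OfSize g n
OfSize-↔ {n = n} A↔B g∘to≡f = Σ-↔ A↔B λ {x} → ≡⇒↔ (cong (_≡ n) (sym (g∘to≡f x)))

-- Schröder numbers

sum-zipWith-applyDownFrom-applyUpTo : ∀ (f g : ℕ → ℕ) n →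
  List.sum (zipWith _*_ (applyDownFrom f n) (applyUpTo g n)) ≡ ∑[ i < n ] (f (n ∸ suc (toℕ i)) * g (toℕ i))
sum-zipWith-applyDownFrom-applyUpTo f g zero    = refl
sum-zipWith-applyDownFrom-applyUpTo f g (suc n) =
  cong (f n * g 0 +_) (sum-zipWith-applyDownFrom-applyUpTo f (g ∘ suc) n)

schroederTable≡applyDownFrom : ∀ m → schroederTable m ≡ applyDownFrom largeSchroeder (suc m)
schroederTable≡applyDownFrom zero    = refl
schroederTable≡applyDownFrom (suc m) = cong (largeSchroeder (suc m) ∷_) (schroederTable≡applyDownFrom m)

private
  large little : ℕ → ℕ
  large  = largeSchroeder
  little = littleSchroeder

largeSchroeder-suc : ∀ m → large (suc m) ≡ large m + ∑[ i ≤ m ] (large (m ∸ toℕ i) * large (toℕ i))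
largeSchroeder-suc m = begin
  large (suc m)
    ≡⟨ unfold m ⟩
  large m + List.sum (zipWith _*_ t (reverse t))
    ≡⟨ cong (λ t → large m + List.sum (zipWith _*_ t (reverse t))) (schroederTable≡applyDownFrom m) ⟩
  large m + List.sum (zipWith _*_ d (reverse d))
    ≡⟨ cong (λ u → large m + List.sum (zipWith _*_ d u)) (reverse-applyDownFrom large (suc m)) ⟩
  large m + List.sum (zipWith _*_ d (applyUpTo large (suc m)))
    ≡⟨ cong (large m +_) (sum-zipWith-applyDownFrom-applyUpTo large large (suc m)) ⟩
  large m + ∑[ i ≤ m ] (large (m ∸ toℕ i) * large (toℕ i))
    ∎
  where
  open ≡-Reasoning
  t d : List ℕ
  t = schroederTable m
  d = applyDownFrom large (suc m)
  unfold : ∀ m → large (suc m) ≡ large m + List.sum (zipWith _*_ (schroederTable m) (reverse (schroederTable m)))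
  unfold zero    = refl
  unfold (suc m) = refl

littleSchroederSum : ℕ → ℕ
littleSchroederSum m = ∑[ i ≤ m ] (large (m ∸ toℕ i) * little (toℕ i))

largeSchroeder-suc≡littleSchroederSum*2 : ∀ m → (∀ j → j < m → large (suc j) ≡ little (suc j) * 2) →
                                          large (suc m) ≡ littleSchroederSum m * 2
largeSchroeder-suc≡littleSchroederSum*2 m even = begin
  large (suc m)                                                   ≡⟨ largeSchroeder-suc m ⟩
  large m + (large m * 1 + ∑[ j < m ] (large (m ∸ suc (toℕ j)) * large (suc (toℕ j))))
    ≡⟨ sym (+-assoc (large m) (large m * 1) _) ⟩
  large m + large m * 1 + ∑[ j < m ] (large (m ∸ suc (toℕ j)) * large (suc (toℕ j)))
    ≡⟨ cong₂ _+_ (double (large m))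
                 (sum-cong-≗ λ j → halve (large (m ∸ suc (toℕ j))) (even (toℕ j) (toℕ<n j))) ⟩
  large m * 1 * 2 + ∑[ j < m ] (large (m ∸ suc (toℕ j)) * little (suc (toℕ j)) * 2)
    ≡⟨ sym (*-distribʳ-sum {suc m} 2 (λ i → large (m ∸ toℕ i) * little (toℕ i))) ⟩
  littleSchroederSum m * 2                                    ∎
  where
  open ≡-Reasoning
  double : ∀ a → a + a * 1 ≡ a * 1 * 2
  double = solve-∀
  halve : ∀ a {b c} → b ≡ c * 2 → a * b ≡ a * c * 2
  halve a {c = c} refl = sym (*-assoc a c 2)

largeSchroeder-even : ∀ m → large (suc m) ≡ little (suc m) * 2
largeSchroeder-even = <-rec (λ m → large (suc m) ≡ little (suc m) * 2) λ m even →
  let S≡ = largeSchroeder-suc≡littleSchroederSum*2 m (λ j j<m → even j<m)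
  in trans S≡ (cong (_* 2) (sym (trans (cong (_/ 2) S≡) (m*n/n≡m (littleSchroederSum m) 2))))

littleSchroeder-suc : ∀ m → little (suc m) ≡ littleSchroederSum m
littleSchroeder-suc m =
  trans (cong (_/ 2) (largeSchroeder-suc≡littleSchroederSum*2 m λ j _ → largeSchroeder-even j))
        (m*n/n≡m (littleSchroederSum m) 2)

-- Counting marked forests

Convolution : ℕ → (ℕ → Set) → (ℕ → Set) → Set
Convolution m P Q = Σ ℕ λ a → Σ ℕ λ b → (b + a ≡ m) × P a × Q b

convolution-zero : ∀ {P Q : ℕ → Set} → Convolution 0 P Q ↔ (P 0 × Q 0)
convolution-zero {P} {Q} = mk↔ₛ′ to (λ (x , y) → 0 , 0 , refl , x , y) (λ _ → refl) from∘to
  where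
  to : Convolution 0 P Q → P 0 × Q 0
  to (_ , zero , refl , x , y) = x , y
  from∘to : ∀ z → (0 , 0 , refl , to z) ≡ z
  from∘to (_ , zero , refl , x , y) = refl

convolution-suc : ∀ {m} {P Q : ℕ → Set} →
                  Convolution (suc m) P Q ↔ (P (suc m) × Q 0 ⊎ Convolution m P (Q ∘ suc))
convolution-suc {m} {P} {Q} = mk↔ₛ′ to from to∘from from∘to
  where
  to : Convolution (suc m) P Q → P (suc m) × Q 0 ⊎ Convolution m P (Q ∘ suc)
  to (_ , zero  , refl , x , y) = inj₁ (x , y)
  to (a , suc b , refl , x , y) = inj₂ (a , b , refl , x , y)
  from : P (suc m) × Q 0 ⊎ Convolution m P (Q ∘ suc) → Convolution (suc m) P Q
  from (inj₁ (x , y))              = suc m , 0 , refl , x , y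
  from (inj₂ (a , b , refl , x , y)) = a , suc b , refl , x , y
  to∘from : ∀ z → to (from z) ≡ z
  to∘from (inj₁ _)                  = refl
  to∘from (inj₂ (a , b , refl , _)) = refl
  from∘to : ∀ z → from (to z) ≡ z
  from∘to (_ , zero  , refl , _) = refl
  from∘to (a , suc b , refl , _) = refl

convolution↔Fin : ∀ m {P Q : ℕ → Set} (f g : ℕ → ℕ) →
                  (∀ a → a ≤ m → P a ↔ Fin (f a)) → (∀ b → b ≤ m → Q b ↔ Fin (g b)) →
                  Convolution m P Q ↔ Fin (∑[ i ≤ m ] (f (m ∸ toℕ i) * g (toℕ i)))
convolution↔Fin zero f g P↔ Q↔ = begin
  Convolution 0 _ _   ↔⟨ convolution-zero ⟩
  (_ × _)             ↔⟨ P↔ 0 z≤n ×-↔ Q↔ 0 z≤n ⟩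
  (Fin (f 0) × Fin (g 0)) ↔⟨ *↔× ⟨
  Fin (f 0 * g 0)     ≡⟨ cong Fin (sym (+-identityʳ _)) ⟩
  Fin (f 0 * g 0 + 0) ∎
  where open EquationalReasoning
convolution↔Fin (suc m) f g P↔ Q↔ = begin
  Convolution (suc m) _ _
    ↔⟨ convolution-suc ⟩
  (_ × _ ⊎ Convolution m _ _)
    ↔⟨ (P↔ (suc m) ≤-refl ×-↔ Q↔ 0 z≤n)
       ⊎-↔ convolution↔Fin m f (g ∘ suc) (λ a a≤m → P↔ a (m≤n⇒m≤1+n a≤m)) (λ b b≤m → Q↔ (suc b) (s≤s b≤m)) ⟩
  (Fin (f (suc m)) × Fin (g 0) ⊎ Fin _)
    ↔⟨ *↔× ⊎-↔ ↔-refl ⟨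
  (Fin (f (suc m) * g 0) ⊎ Fin _)
    ↔⟨ +↔⊎ ⟨
  Fin _ ∎
  where open EquationalReasoning

data MarkedTree : Set where
  leaf : MarkedTree
  node : Bool → MarkedTree → List MarkedTree → MarkedTree

size  : MarkedTree → ℕ
sizes : List MarkedTree → ℕ
size leaf          = 1
size (node _ t ts) = suc (size t + sizes ts)
sizes []       = 0
sizes (t ∷ ts) = size t + sizes ts

MarkedForest : ℕ → Set
MarkedForest = OfSize sizes

MarkedTreeOfSize : ℕ → Set
MarkedTreeOfSize = OfSize size

markedForest-zero : MarkedForest 0 ↔ ⊤
markedForest-zero = mk↔ₛ′ _ (λ _ → [] , refl) (λ _ → refl) from∘to
  where
  from∘to : ∀ f → ([] , refl) ≡ f
  from∘to ([] , refl)                 = refl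
  from∘to ((leaf ∷ _) , ())
  from∘to ((node _ _ _ ∷ _) , ())

markedForest-suc : ∀ {m} → MarkedForest (suc m) ↔ Convolution m (MarkedTreeOfSize ∘ suc) MarkedForest
markedForest-suc {m} = mk↔ₛ′ to from to∘from from∘to
  where
  to : MarkedForest (suc m) → Convolution m (MarkedTreeOfSize ∘ suc) MarkedForest
  to (leaf ∷ ts , p)          = 0 , sizes ts , trans (+-identityʳ _) (suc-injective p) , (leaf , refl) , (ts , refl)
  to (node b t us ∷ ts , p)   = size t + sizes us , sizes ts , trans (+-comm (sizes ts) _) (suc-injective p) ,
                                (node b t us , refl) , (ts , refl)
  from : Convolution m (MarkedTreeOfSize ∘ suc) MarkedForest → MarkedForest (suc m)
  from (a , b , b+a≡m , (t , p) , (ts , q)) = t ∷ ts , trans (cong₂ _+_ p q) (cong suc (trans (+-comm a b) b+a≡m))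
  to∘from : ∀ z → to (from z) ≡ z
  to∘from (a , b , _ , (leaf , refl) , (ts , refl)) =
    cong (λ e → a , b , e , (leaf , refl) , (ts , refl)) (≡-irrelevant _ _)
  to∘from (a , b , _ , (node c t us , refl) , (ts , refl)) =
    cong (λ e → a , b , e , (node c t us , refl) , (ts , refl)) (≡-irrelevant _ _)
  from∘to : ∀ f → from (to f) ≡ f
  from∘to (leaf ∷ _ , _)         = OfSize-≡ refl
  from∘to (node _ _ _ ∷ _ , _)   = OfSize-≡ refl

markedTreeOfSize-one : MarkedTreeOfSize 1 ↔ ⊤
markedTreeOfSize-one = mk↔ₛ′ _ (λ _ → leaf , refl) (λ _ → refl) from∘to
  where
  from∘to : ∀ t → (leaf , refl) ≡ t
  from∘to (leaf , refl)              = refl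
  from∘to (node _ leaf _ , ())
  from∘to (node _ (node _ _ _) _ , ())

markedTreeOfSize-suc : ∀ {n} → MarkedTreeOfSize (suc (suc n)) ↔ (MarkedForest (suc n) × Bool)
markedTreeOfSize-suc {n} = mk↔ₛ′ to from to∘from from∘to
  where
  to : MarkedTreeOfSize (suc (suc n)) → MarkedForest (suc n) × Bool
  to (node b t ts , p) = (t ∷ ts , suc-injective p) , b
  from : MarkedForest (suc n) × Bool → MarkedTreeOfSize (suc (suc n))
  from ((t ∷ ts , p) , b) = node b t ts , cong suc p
  to∘from : ∀ z → to (from z) ≡ z
  to∘from ((t ∷ ts , p) , b) = cong (λ q → (t ∷ ts , q) , b) (≡-irrelevant _ _)
  from∘to : ∀ t → from (to t) ≡ t
  from∘to (node b t ts , p) = OfSize-≡ refl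

markedForest↔Fin≤     : ∀ m n → n ≤ m → MarkedForest n ↔ Fin (littleSchroeder n)
markedTreeOfSize↔Fin≤ : ∀ m n → n ≤ m → MarkedTreeOfSize (suc n) ↔ Fin (largeSchroeder n)
markedForest↔Fin≤ m       zero    _         = ↔-trans markedForest-zero (↔-sym 1↔⊤)
markedForest↔Fin≤ (suc m) (suc n) (s≤s n≤m) = begin
  MarkedForest (suc n)                                 ↔⟨ markedForest-suc ⟩
  Convolution n (MarkedTreeOfSize ∘ suc) MarkedForest  ↔⟨ convolution↔Fin n largeSchroeder littleSchroeder
                                                            (λ a a≤n → markedTreeOfSize↔Fin≤ m a (≤-trans a≤n n≤m))
                                                            (λ b b≤n → markedForest↔Fin≤ m b (≤-trans b≤n n≤m)) ⟩
  Fin (littleSchroederSum n)                           ≡⟨ cong Fin (littleSchroeder-suc n) ⟨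
  Fin (littleSchroeder (suc n))                        ∎
  where open EquationalReasoning
markedTreeOfSize↔Fin≤ m zero    _   = ↔-trans markedTreeOfSize-one (↔-sym 1↔⊤)
markedTreeOfSize↔Fin≤ m (suc n) n≤m = begin
  MarkedTreeOfSize (suc (suc n))                ↔⟨ markedTreeOfSize-suc ⟩
  (MarkedForest (suc n) × Bool)                 ↔⟨ markedForest↔Fin≤ m (suc n) n≤m ×-↔ ↔-sym 2↔Bool ⟩
  (Fin (littleSchroeder (suc n)) × Fin 2)       ↔⟨ *↔× ⟨
  Fin (littleSchroeder (suc n) * 2)             ≡⟨ cong Fin (largeSchroeder-even n) ⟨
  Fin (largeSchroeder (suc n))                  ∎
  where open EquationalReasoning

markedForest↔Fin : ∀ n → MarkedForest n ↔ Fin (littleSchroeder n)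
markedForest↔Fin n = markedForest↔Fin≤ n n ≤-refl

-- Dyck paths and plane forests

data PlaneTree : Set where
  node : List PlaneTree → PlaneTree

ups : ℕ → List Step
ups k = replicate k U

code  : PlaneTree → List Step
codes : List PlaneTree → List Step
code (node ts)  = ups (length ts) ++ codes ts
codes []       = []
codes (t ∷ ts) = D ∷ code t ++ codes ts

encode : ℕ → List PlaneTree → List Step
encode j ts = ups j ++ codes ts

codes-++ : ∀ ts us → codes (ts ++ us) ≡ codes ts ++ codes us
codes-++ []       us = refl
codes-++ (t ∷ ts) us = cong (D ∷_) (begin
  code t ++ codes (ts ++ us)        ≡⟨ cong (code t ++_) (codes-++ ts us) ⟩
  code t ++ (codes ts ++ codes us)  ≡⟨ ++-assoc (code t) (codes ts) (codes us) ⟨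
  (code t ++ codes ts) ++ codes us  ∎)
  where open ≡-Reasoning

encode-node : ∀ us ts → encode 0 (node us ∷ ts) ≡ D ∷ encode (length us) (us ++ ts)
encode-node us ts = cong (D ∷_) (begin
  (ups (length us) ++ codes us) ++ codes ts  ≡⟨ ++-assoc (ups (length us)) (codes us) (codes ts) ⟩
  ups (length us) ++ (codes us ++ codes ts)  ≡⟨ cong (ups (length us) ++_) (codes-++ us ts) ⟨
  encode (length us) (us ++ ts)              ∎)
  where open ≡-Reasoning

encode-node⁻ : ∀ us ts {s} → encode 0 (node us ∷ ts) ≡ D ∷ s → encode (length us) (us ++ ts) ≡ s
encode-node⁻ us ts eq = ∷-injectiveʳ (trans (sym (encode-node us ts)) eq)

-- For length ts = j + h, encode j ts is what remains of a code after it has climbed to height h;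
-- decode h undoes this, each down-step closing a vertex whose children are the next j trees
-- (the value on paths that go below the axis is junk).
decode : ℕ → List Step → ℕ × List PlaneTree
decode h       []      = 0 , []
decode h       (U ∷ s) = map₁ suc (decode (suc h) s)
decode zero    (D ∷ s) = 0 , []
decode (suc h) (D ∷ s) = let j , ts = decode h s in 0 , node (take j ts) ∷ drop j ts

dyckFrom-U : ∀ h s → T (dyckFrom h (U ∷ s)) → T (dyckFrom (suc h) s)
dyckFrom-U zero    s d = d
dyckFrom-U (suc h) s d = d

U-dyckFrom : ∀ h s → T (dyckFrom (suc h) s) → T (dyckFrom h (U ∷ s))
U-dyckFrom zero    s d = d
U-dyckFrom (suc h) s d = d

length-decode : ∀ h s → T (dyckFrom h s) → length (proj₂ (decode h s)) ≡ proj₁ (decode h s) + h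
length-decode zero    []      _ = refl
length-decode h       (U ∷ s) d = trans (length-decode (suc h) s (dyckFrom-U h s d)) (+-suc _ h)
length-decode (suc h) (D ∷ s) d = cong suc (begin
  length (drop j ts)  ≡⟨ length-drop j ts ⟩
  length ts ∸ j       ≡⟨ cong (_∸ j) (length-decode h s d) ⟩
  j + h ∸ j           ≡⟨ m+n∸m≡n j h ⟩
  h                   ∎)
  where
  open ≡-Reasoning
  j : ℕ
  j = proj₁ (decode h s)
  ts : List PlaneTree
  ts = proj₂ (decode h s)

take-length-++ : ∀ {A : Set} (xs ys : List A) → take (length xs) (xs ++ ys) ≡ xs
take-length-++ []       ys = refl
take-length-++ (x ∷ xs) ys = cong (x ∷_) (take-length-++ xs ys)

drop-length-++ : ∀ {A : Set} (xs ys : List A) → drop (length xs) (xs ++ ys) ≡ ys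
drop-length-++ []       ys = refl
drop-length-++ (x ∷ xs) ys = drop-length-++ xs ys

encode-decode : ∀ h s → T (dyckFrom h s) → encode (proj₁ (decode h s)) (proj₂ (decode h s)) ≡ s
encode-decode zero    []      _ = refl
encode-decode h       (U ∷ s) d = cong (U ∷_) (encode-decode (suc h) s (dyckFrom-U h s d))
encode-decode (suc h) (D ∷ s) d = begin
  encode 0 (node (take j ts) ∷ drop j ts)
    ≡⟨ encode-node (take j ts) (drop j ts) ⟩
  D ∷ encode (length (take j ts)) (take j ts ++ drop j ts)
    ≡⟨ cong₂ (λ k us → D ∷ encode k us) (trans (length-take j ts) (m≤n⇒m⊓n≡m j≤)) (take++drop≡id j ts) ⟩
  D ∷ encode j ts
    ≡⟨ cong (D ∷_) (encode-decode h s d) ⟩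
  D ∷ s
    ∎
  where
  open ≡-Reasoning
  j : ℕ
  j = proj₁ (decode h s)
  ts : List PlaneTree
  ts = proj₂ (decode h s)
  j≤ : j ≤ length ts
  j≤ = subst (j ≤_) (sym (length-decode h s d)) (m≤m+n j h)

decode-encode : ∀ h s j ts → length ts ≡ j + h → encode j ts ≡ s → T (dyckFrom h s) × decode h s ≡ (j , ts)
decode-encode zero    []      zero    []             _   _  = _ , refl
decode-encode h       (U ∷ s) (suc j) ts             len eq
  with dyck , dec ← decode-encode (suc h) s j ts (trans len (sym (+-suc j h))) (∷-injectiveʳ eq)
  = U-dyckFrom h s dyck , cong (map₁ suc) dec
decode-encode (suc h) (D ∷ s) zero    (node us ∷ ts) len eq
  with dyck , dec ← decode-encode h s (length us) (us ++ ts) (trans (length-++ us) (cong (length us +_) (suc-injective len)))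
                                  (encode-node⁻ us ts eq)
  rewrite dec = dyck , cong₂ (λ vs ws → 0 , node vs ∷ ws) (take-length-++ us ts) (drop-length-++ us ts)
decode-encode (suc h) []      zero    []             ()  _
decode-encode zero    (D ∷ s) zero    (node _ ∷ _)   ()  _
decode-encode h       []      zero    (node _ ∷ _)   _   ()
decode-encode h       []      (suc j) ts             _   ()
decode-encode h       (U ∷ s) zero    []             _   ()
decode-encode h       (U ∷ s) zero    (node _ ∷ _)   _   ()
decode-encode h       (D ∷ s) zero    []             _   ()
decode-encode h       (D ∷ s) (suc j) ts             _   ()

internal  : PlaneTree → ℕ
internals : List PlaneTree → ℕ
internal (node [])       = 0
internal (node (t ∷ ts)) = suc (internals (t ∷ ts))
internals []       = 0
internals (t ∷ ts) = internal t + internals ts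

internals-++ : ∀ ts us → internals (ts ++ us) ≡ internals ts + internals us
internals-++ []       us = refl
internals-++ (t ∷ ts) us = trans (cong (internal t +_) (internals-++ ts us)) (sym (+-assoc (internal t) _ _))

valleys-encode : ∀ s j ts → encode j ts ≡ s → valleys s ≡ internals ts
valleys-encode []          zero    []                    _  = refl
valleys-encode (U ∷ s)     (suc j) ts                    eq = valleys-encode s j ts (∷-injectiveʳ eq)
valleys-encode (D ∷ s)     zero    (node [] ∷ ts)        eq = begin
  valleys (D ∷ s)         ≡⟨ cong (λ s → valleys (D ∷ s)) (sym e) ⟩
  valleys (D ∷ codes ts)  ≡⟨ valleys-D-codes ts ⟩
  valleys (codes ts)      ≡⟨ cong valleys e ⟩
  valleys s               ≡⟨ valleys-encode s 0 ts e ⟩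
  internals ts            ∎
  where
  open ≡-Reasoning
  e : codes ts ≡ s
  e = ∷-injectiveʳ eq
  valleys-D-codes : ∀ ts → valleys (D ∷ codes ts) ≡ valleys (codes ts)
  valleys-D-codes []      = refl
  valleys-D-codes (_ ∷ _) = refl
valleys-encode (D ∷ U ∷ s) zero    (node (u ∷ us) ∷ ts) eq = cong suc (begin
  valleys (U ∷ s)                    ≡⟨ valleys-encode (U ∷ s) (length (u ∷ us)) (u ∷ us ++ ts) (encode-node⁻ (u ∷ us) ts eq) ⟩
  internals (u ∷ us ++ ts)           ≡⟨ internals-++ (u ∷ us) ts ⟩
  internals (u ∷ us) + internals ts  ∎)
  where open ≡-Reasoning
valleys-encode (D ∷ D ∷ s) zero    (node (u ∷ us) ∷ ts) eq with () ← encode-node⁻ (u ∷ us) ts eq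
valleys-encode (D ∷ [])    zero    (node (u ∷ us) ∷ ts) eq with () ← encode-node⁻ (u ∷ us) ts eq
valleys-encode []          zero    (node _ ∷ _)          ()
valleys-encode []          (suc j) ts                    ()
valleys-encode (U ∷ s)     zero    []                    ()
valleys-encode (U ∷ s)     zero    (node _ ∷ _)          ()
valleys-encode (D ∷ s)     zero    []                    ()
valleys-encode (D ∷ s)     (suc j) ts                    ()

vertices  : PlaneTree → ℕ
verticesF : List PlaneTree → ℕ
vertices (node ts) = suc (verticesF ts)
verticesF []       = 0
verticesF (t ∷ ts) = vertices t + verticesF ts

length-code : ∀ ts → length (code (node ts)) ≡ length ts + length (codes ts)
length-code ts = trans (length-++ (ups (length ts))) (cong (_+ length (codes ts)) (length-replicate (length ts)))

length-codes : ∀ ts → length ts + length (codes ts) ≡ 2 * verticesF ts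
length-codes []             = refl
length-codes (node us ∷ ts) = begin
  suc (length ts) + suc (length (code (node us) ++ codes ts))
    ≡⟨ cong (λ n → suc (length ts) + suc n) (trans (length-++ (code (node us))) (cong (_+ _) (length-code us))) ⟩
  suc (length ts) + suc (length us + length (codes us) + length (codes ts))
    ≡⟨ rearrange (length ts) (length us) (length (codes us)) (length (codes ts)) ⟩
  2 + (length us + length (codes us)) + (length ts + length (codes ts))
    ≡⟨ cong₂ (λ a b → 2 + a + b) (length-codes us) (length-codes ts) ⟩
  2 + 2 * verticesF us + 2 * verticesF ts
    ≡⟨ double (verticesF us) (verticesF ts) ⟩
  2 * (suc (verticesF us) + verticesF ts)
    ∎
  where
  open ≡-Reasoning
  rearrange : ∀ a b c d → suc a + suc (b + c + d) ≡ 2 + (b + c) + (a + d)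
  rearrange = solve-∀
  double : ∀ a b → 2 + 2 * a + 2 * b ≡ 2 * (suc a + b)
  double = solve-∀

length-encode : ∀ ts → length (encode (length ts) ts) ≡ 2 * verticesF ts
length-encode ts = trans (length-code ts) (length-codes ts)

DyckPath : Set
DyckPath = Σ (List Step) λ s → T (dyckFrom 0 s)

forest : DyckPath → List PlaneTree
forest (s , _) = proj₂ (decode 0 s)

encode-forest : ∀ s (d : T (dyckFrom 0 s)) → encode (length (forest (s , d))) (forest (s , d)) ≡ s
encode-forest s d = trans (cong (λ j → encode j (proj₂ (decode 0 s))) (trans (length-decode 0 s d) (+-identityʳ _)))
                          (encode-decode 0 s d)

dyckPath↔planeForest : DyckPath ↔ List PlaneTree
dyckPath↔planeForest = mk↔ₛ′ forest from forest∘from from∘forest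
  where
  from : List PlaneTree → DyckPath
  from ts = encode (length ts) ts , proj₁ (decode-encode 0 _ (length ts) ts (sym (+-identityʳ _)) refl)
  forest∘from : ∀ ts → forest (from ts) ≡ ts
  forest∘from ts = cong proj₂ (proj₂ (decode-encode 0 _ (length ts) ts (sym (+-identityʳ _)) refl))
  from∘forest : ∀ p → from (forest p) ≡ p
  from∘forest (s , d) = Σ-≡,≡→≡ (encode-forest s d , T-irrelevant _ _)

MarkedPlaneForest : Set
MarkedPlaneForest = Σ (List PlaneTree) λ ts → Vec Bool (internals ts)

unmark  : MarkedTree → Σ PlaneTree λ t → Vec Bool (internal t)
unmarks : List MarkedTree → MarkedPlaneForest
unmark leaf          = node [] , []
unmark (node b t ts) = let u , v = unmark t ; us , w = unmarks ts in node (u ∷ us) , b ∷ (v ++ᵛ w)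
unmarks []       = [] , []
unmarks (t ∷ ts) = let u , v = unmark t ; us , w = unmarks ts in u ∷ us , v ++ᵛ w

mark  : (t : PlaneTree) → Vec Bool (internal t) → MarkedTree
marks : (ts : List PlaneTree) → Vec Bool (internals ts) → List MarkedTree
mark (node [])       _       = leaf
mark (node (t ∷ ts)) (b ∷ v) = node b (mark t (takeᵛ (internal t) v)) (marks ts (dropᵛ (internal t) v))
marks []       _ = []
marks (t ∷ ts) v = mark t (takeᵛ (internal t) v) ∷ marks ts (dropᵛ (internal t) v)

take-++ᵛ : ∀ {m n} (v : Vec Bool m) (w : Vec Bool n) → takeᵛ m (v ++ᵛ w) ≡ v
take-++ᵛ {m} v w = proj₁ (++-injective (takeᵛ m (v ++ᵛ w)) v (take++drop≡idᵛ m (v ++ᵛ w)))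

drop-++ᵛ : ∀ {m n} (v : Vec Bool m) (w : Vec Bool n) → dropᵛ m (v ++ᵛ w) ≡ w
drop-++ᵛ {m} v w = proj₂ (++-injective (takeᵛ m (v ++ᵛ w)) v (take++drop≡idᵛ m (v ++ᵛ w)))

mark-unmark  : ∀ t  → uncurry mark (unmark t) ≡ t
marks-unmarks : ∀ ts → uncurry marks (unmarks ts) ≡ ts
mark-unmark leaf = refl
mark-unmark (node b t ts)
  rewrite take-++ᵛ (proj₂ (unmark t)) (proj₂ (unmarks ts)) | drop-++ᵛ (proj₂ (unmark t)) (proj₂ (unmarks ts))
  = cong₂ (node b) (mark-unmark t) (marks-unmarks ts)
marks-unmarks [] = refl
marks-unmarks (t ∷ ts)
  rewrite take-++ᵛ (proj₂ (unmark t)) (proj₂ (unmarks ts)) | drop-++ᵛ (proj₂ (unmark t)) (proj₂ (unmarks ts))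
  = cong₂ _∷_ (mark-unmark t) (marks-unmarks ts)

unmark-mark  : ∀ t v → unmark (mark t v) ≡ (t , v)
unmarks-marks : ∀ ts v → unmarks (marks ts v) ≡ (ts , v)
unmark-mark (node [])       [] = refl
unmark-mark (node (t ∷ ts)) (b ∷ v) =
  trans (cong₂ (λ x y → node (proj₁ x ∷ proj₁ y) , b ∷ (proj₂ x ++ᵛ proj₂ y))
               (unmark-mark t (takeᵛ (internal t) v)) (unmarks-marks ts (dropᵛ (internal t) v)))
        (cong (λ w → node (t ∷ ts) , b ∷ w) (take++drop≡idᵛ (internal t) v))
unmarks-marks []       [] = refl
unmarks-marks (t ∷ ts) v =
  trans (cong₂ (λ x y → proj₁ x ∷ proj₁ y , proj₂ x ++ᵛ proj₂ y)
               (unmark-mark t (takeᵛ (internal t) v)) (unmarks-marks ts (dropᵛ (internal t) v)))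
        (cong (t ∷ ts ,_) (take++drop≡idᵛ (internal t) v))

vertices-unmark  : ∀ t  → vertices (proj₁ (unmark t)) ≡ size t
verticesF-unmarks : ∀ ts → verticesF (proj₁ (unmarks ts)) ≡ sizes ts
vertices-unmark leaf          = refl
vertices-unmark (node b t ts) = cong suc (cong₂ _+_ (vertices-unmark t) (verticesF-unmarks ts))
verticesF-unmarks []       = refl
verticesF-unmarks (t ∷ ts) = cong₂ _+_ (vertices-unmark t) (verticesF-unmarks ts)

markedTrees↔markedPlaneForest : List MarkedTree ↔ MarkedPlaneForest
markedTrees↔markedPlaneForest = mk↔ₛ′ unmarks (uncurry marks) (λ (ts , v) → unmarks-marks ts v) marks-unmarks

valleys-forest : ∀ p → valleys (proj₁ p) ≡ internals (forest p)
valleys-forest (s , d) = valleys-encode s _ (forest (s , d)) (encode-forest s d)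

length≡2*verticesF : ∀ p → length (proj₁ p) ≡ 2 * verticesF (forest p)
length≡2*verticesF (s , d) = trans (cong length (sym (encode-forest s d))) (length-encode (forest (s , d)))

markedDyck↔markedForest : ∀ n → MarkedDyck n ↔ MarkedForest n
markedDyck↔markedForest n = begin
  MarkedDyck n
    ↔⟨ split-IsDyck ⟩
  (Σ (Σ DyckPath λ p → Vec Bool (valleys (proj₁ p))) λ q → length (proj₁ (proj₁ q)) ≡ 2 * n)
    ↔⟨ Σ-↔ (Σ-↔ dyckPath↔planeForest λ {p} → ≡⇒↔ (cong (Vec Bool) (valleys-forest p)))
           (λ {q} → mk↔-irrelevant ≡-irrelevant ≡-irrelevant (halve q) (double q)) ⟩
  OfSize (verticesF ∘ proj₁) n
    ↔⟨ OfSize-↔ markedTrees↔markedPlaneForest verticesF-unmarks ⟨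
  MarkedForest n ∎
  where
  open EquationalReasoning
  halve : ∀ q → length (proj₁ (proj₁ q)) ≡ 2 * n → verticesF (forest (proj₁ q)) ≡ n
  halve (p , _) ℓ = *-cancelˡ-≡ _ _ 2 (trans (sym (length≡2*verticesF p)) ℓ)
  double : ∀ q → verticesF (forest (proj₁ q)) ≡ n → length (proj₁ (proj₁ q)) ≡ 2 * n
  double (p , _) refl = length≡2*verticesF p
  split-IsDyck : MarkedDyck n ↔
                 (Σ (Σ DyckPath λ p → Vec Bool (valleys (proj₁ p))) λ q → length (proj₁ (proj₁ q)) ≡ 2 * n)
  split-IsDyck = mk↔ₛ′
    (λ (s , d , v) → let d₀ , dℓ = Equivalence.to T-∧ d in ((s , d₀) , v) , ≡ᵇ⇒≡ _ _ dℓ)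
    (λ (((s , d₀) , v) , ℓ) → s , Equivalence.from T-∧ (d₀ , ≡⇒≡ᵇ _ _ ℓ) , v)
    (λ (((s , d₀) , v) , ℓ) → cong₂ (λ d ℓ → ((s , d) , v) , ℓ) (T-irrelevant _ _) (≡-irrelevant _ _))
    (λ (s , d , v) → cong (λ d → s , d , v) (T-irrelevant _ _))

-- The Schröder generating tree

SchroederChild : ℕ → Set
SchroederChild d = ⊤ ⊎ Bool × Σ ℕ (_< d)

childLabel : (d : ℕ) → SchroederChild d → ℕ
childLabel d (inj₁ _)           = suc d
childLabel d (inj₂ (_ , j , _)) = d ∸ j

record SchroederGrowth (X : ℕ → Set) : Set where
  field
    label      : ∀ {n} → X n → ℕ
    root       : X 0 ↔ ⊤
    label-root : label (Inverse.from root tt) ≡ 0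
    grow       : ∀ {n} → X (suc n) ↔ Σ (X n) (SchroederChild ∘ label)
    label-grow : ∀ {n} (x : X n) c → label (Inverse.from grow (x , c)) ≡ childLabel (label x) c

-- The nodes of depth n and label e of the generating tree with root label 0, as paths from the root.
SchroederNodes : ℕ → ℕ → Set
SchroederNodes zero    e = e ≡ 0
SchroederNodes (suc n) e = Σ ℕ λ d → SchroederNodes n d × Σ (SchroederChild d) λ c → childLabel d c ≡ e

↔Σ-fibres : ∀ {A : Set} (f : A → ℕ) → A ↔ Σ ℕ (OfSize f)
↔Σ-fibres f = mk↔ₛ′ (λ x → f x , x , refl) (λ (_ , x , _) → x) (λ { (_ , x , refl) → refl }) (λ _ → refl)

module _ {X : ℕ → Set} (G : SchroederGrowth X) where
  open SchroederGrowth G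

  fibre↔SchroederNodes : ∀ n e → OfSize (label {n}) e ↔ SchroederNodes n e
  fibre↔SchroederNodes zero e =
    mk↔ₛ′ (λ (x , p) → trans (sym p) (label≡0 x)) (λ q → Inverse.from root tt , trans label-root (sym q))
          (λ _ → ≡-irrelevant _ _) (λ (x , _) → OfSize-≡ (Inverse.strictlyInverseʳ root x))
    where
    label≡0 : (x : X 0) → label x ≡ 0
    label≡0 x = trans (cong label (sym (Inverse.strictlyInverseʳ root x))) label-root
  fibre↔SchroederNodes (suc n) e = begin
    OfSize (label {suc n}) e
      ↔⟨ OfSize-↔ grow (λ x → trans (sym (label-grow _ _)) (cong label (Inverse.strictlyInverseʳ grow x))) ⟩
    OfSize (λ (x , c) → childLabel (label x) c) e
      ↔⟨ regroup ⟩
    (Σ ℕ λ d → OfSize (label {n}) d × Σ (SchroederChild d) λ c → childLabel d c ≡ e)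
      ↔⟨ Σ-↔ ↔-refl (fibre↔SchroederNodes n _ ×-↔ ↔-refl) ⟩
    SchroederNodes (suc n) e ∎
    where
    open EquationalReasoning
    regroup : OfSize (λ (x , c) → childLabel (label x) c) e ↔
              (Σ ℕ λ d → OfSize (label {n}) d × Σ (SchroederChild d) λ c → childLabel d c ≡ e)
    regroup = mk↔ₛ′ to from to∘from (λ _ → refl)
      where
      to : OfSize (λ (x , c) → childLabel (label x) c) e →
           Σ ℕ λ d → OfSize (label {n}) d × Σ (SchroederChild d) λ c → childLabel d c ≡ e
      to ((x , c) , p) = label x , (x , refl) , c , p
      from : (Σ ℕ λ d → OfSize (label {n}) d × Σ (SchroederChild d) λ c → childLabel d c ≡ e) →
             OfSize (λ (x , c) → childLabel (label x) c) e
      from (_ , (x , refl) , c , p) = (x , c) , p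
      to∘from : ∀ y → to (from y) ≡ y
      to∘from (_ , (x , refl) , c , p) = refl

  ↔ΣSchroederNodes : ∀ n → X n ↔ Σ ℕ (SchroederNodes n)
  ↔ΣSchroederNodes n = ↔-trans (↔Σ-fibres label) (Σ-↔ ↔-refl (fibre↔SchroederNodes n _))

schroederGrowth-↔ : ∀ {X Y : ℕ → Set} → SchroederGrowth X → SchroederGrowth Y → ∀ n → X n ↔ Y n
schroederGrowth-↔ GX GY n = ↔-trans (↔ΣSchroederNodes GX n) (↔-sym (↔ΣSchroederNodes GY n))

sizes-++ : ∀ ts us → sizes (ts ++ us) ≡ sizes ts + sizes us
sizes-++ []       us = refl
sizes-++ (t ∷ ts) us = trans (cong (size t +_) (sizes-++ ts us)) (sym (+-assoc (size t) _ _))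

markedForestGrowth : SchroederGrowth MarkedForest
markedForestGrowth = record
  { label      = length ∘ proj₁
  ; root       = markedForest-zero
  ; label-root = refl
  ; grow       = mk↔ₛ′ prune graft prune∘graft graft∘prune
  ; label-grow = label-graft
  }
  where
  prune : ∀ {n} → MarkedForest (suc n) → Σ (MarkedForest n) (SchroederChild ∘ length ∘ proj₁)
  prune (leaf ∷ ts , p)        = (ts , suc-injective p) , inj₁ tt
  prune (node b t us ∷ ts , p) = (t ∷ us ++ ts , trans (sizes-++ (t ∷ us) ts) (suc-injective p)) ,
                                 inj₂ (b , length us , s≤s (length-++-≤ˡ us))
  graft : ∀ {n} → Σ (MarkedForest n) (SchroederChild ∘ length ∘ proj₁) → MarkedForest (suc n)
  graft ((ts , p) , inj₁ _)               = leaf ∷ ts , cong suc p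
  graft ((t ∷ ts , p) , inj₂ (b , j , _)) = node b t (take j ts) ∷ drop j ts ,
    cong suc (trans (sym (sizes-++ (t ∷ take j ts) (drop j ts)))
                    (trans (cong (λ us → sizes (t ∷ us)) (take++drop≡id j ts)) p))
  prune∘graft : ∀ {n} (z : Σ (MarkedForest n) (SchroederChild ∘ length ∘ proj₁)) → prune (graft z) ≡ z
  prune∘graft ((ts , p) , inj₁ tt)              = cong (λ p → (ts , p) , inj₁ tt) (≡-irrelevant _ _)
  prune∘graft ((t ∷ ts , p) , inj₂ (b , j , j<)) =
    pruned-≡ (cong (t ∷_) (take++drop≡id j ts)) (trans (length-take j ts) (m≤n⇒m⊓n≡m (≤-pred j<)))
    where
    pruned-≡ : ∀ {n} {ts us : List MarkedTree} {p q} {b j k j< k<} → ts ≡ us → j ≡ k →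
               _≡_ {A = Σ (MarkedForest n) (SchroederChild ∘ length ∘ proj₁)}
                   ((ts , p) , inj₂ (b , j , j<)) ((us , q) , inj₂ (b , k , k<))
    pruned-≡ {ts = ts} {b = b} {j} refl refl =
      cong₂ (λ p j< → (ts , p) , inj₂ (b , j , j<)) (≡-irrelevant _ _) (<-irrelevant _ _)
  graft∘prune : ∀ {n} (f : MarkedForest (suc n)) → graft (prune f) ≡ f
  graft∘prune (leaf ∷ _ , _)         = OfSize-≡ refl
  graft∘prune (node b t us ∷ ts , _) =
    OfSize-≡ (cong₂ (λ vs ws → node b t vs ∷ ws) (take-length-++ us ts) (drop-length-++ us ts))
  label-graft : ∀ {n} (f : MarkedForest n) c → length (proj₁ (graft (f , c))) ≡ childLabel (length (proj₁ f)) c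
  label-graft (ts , p)     (inj₁ tt)              = refl
  label-graft (t ∷ ts , p) (inj₂ (b , j , j<)) = trans (cong suc (length-drop j ts)) (sym (+-∸-assoc 1 (≤-pred j<)))

-- Rank words

-- shift x renumbers the blocks to make room for a new block x; unshift x closes that gap again.
shift : ℕ → ℕ → ℕ
shift x v with v <? x
... | yes _ = v
... | no  _ = suc v

unshift : ℕ → ℕ → ℕ
unshift x v with v <? x
... | yes _ = v
... | no  _ = pred v

shift-< : ∀ {x v} → v < x → shift x v ≡ v
shift-< {x} {v} v<x with v <? x
... | yes _   = refl
... | no  v≮x = ⊥-elim (v≮x v<x)

shift-≥ : ∀ {x v} → x ≤ v → shift x v ≡ suc v
shift-≥ {x} {v} x≤v with v <? x
... | yes v<x = ⊥-elim (<⇒≱ v<x x≤v)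
... | no  _   = refl

unshift-< : ∀ {x v} → v < x → unshift x v ≡ v
unshift-< {x} {v} v<x with v <? x
... | yes _   = refl
... | no  v≮x = ⊥-elim (v≮x v<x)

unshift-shift : ∀ x v → unshift x (shift x v) ≡ v
unshift-shift x v with v <? x
... | yes v<x = unshift-< v<x
... | no  v≮x with suc v <? x
...   | yes 1+v<x = ⊥-elim (v≮x (<-trans (n<1+n v) 1+v<x))
...   | no  _     = refl

shift-unshift : ∀ x v → v ≢ x → shift x (unshift x v) ≡ v
shift-unshift x v       v≢x with v <? x
... | yes v<x = shift-< v<x
shift-unshift x zero    v≢x | no v≮x = ⊥-elim (v≢x (sym (n≤0⇒n≡0 (≮⇒≥ v≮x))))
shift-unshift x (suc v) v≢x | no v≮x = shift-≥ (≤-pred (≤∧≢⇒< (≮⇒≥ v≮x) (v≢x ∘ sym)))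

shift≢ : ∀ x v → shift x v ≢ x
shift≢ x v with v <? x
... | yes v<x = <⇒≢ v<x
... | no  v≮x = λ 1+v≡x → v≮x (subst (v <_) 1+v≡x (n<1+n v))

shift-mono-< : ∀ x {u v} → u < v → shift x u < shift x v
shift-mono-< x {u} {v} u<v with u <? x | v <? x
... | yes _   | yes _   = u<v
... | yes _   | no  _   = m<n⇒m<1+n u<v
... | no  u≮x | yes v<x = ⊥-elim (u≮x (<-trans u<v v<x))
... | no  _   | no  _   = s≤s u<v

shift-cancel-< : ∀ x {u v} → shift x u < shift x v → u < v
shift-cancel-< x {u} {v} su<sv with <-cmp u v
... | tri< u<v _ _ = u<v
... | tri≈ _ refl _ = ⊥-elim (<-irrefl refl su<sv)
... | tri> _ _ v<u = ⊥-elim (<-asym su<sv (shift-mono-< x v<u))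

shift-injective : ∀ x {u v} → shift x u ≡ shift x v → u ≡ v
shift-injective x {u} {v} su≡sv with <-cmp u v
... | tri< u<v _ _ = ⊥-elim (<⇒≢ (shift-mono-< x u<v) su≡sv)
... | tri≈ _ u≡v _ = u≡v
... | tri> _ _ v<u = ⊥-elim (<⇒≢ (shift-mono-< x v<u) (sym su≡sv))

≤⇔<shift : ∀ x v → x ≤ v ⇔ x < shift x v
≤⇔<shift x v = mk⇔ (λ x≤v → subst (x <_) (sym (shift-≥ x≤v)) (s≤s x≤v)) from
  where
  from : x < shift x v → x ≤ v
  from x<sv with v <? x
  ... | yes v<x = ⊥-elim (<-asym x<sv v<x)
  ... | no  v≮x = ≮⇒≥ v≮x

occurs : ℕ → Vec ℕ n → Bool
occurs v []      = false
occurs v (y ∷ w) with v ≟ y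
... | yes _ = true
... | no  _ = occurs v w

someAtLeast : ℕ → Vec ℕ n → Bool
someAtLeast x []      = false
someAtLeast x (y ∷ w) with x ≤? y
... | yes _ = true
... | no  _ = someAtLeast x w

-- The least y such that y ∷ w has no stopping pattern starting at y (stopAbove⇔<threshold).
threshold : Vec ℕ n → ℕ
threshold []      = 0
threshold (y ∷ w) = if someAtLeast (suc y) w then suc y else threshold w

Bounded : ℕ → Vec ℕ n → Set
Bounded k []      = ⊤
Bounded k (y ∷ w) = y < k × Bounded k w

Covers : ℕ → Vec ℕ n → Set
Covers zero    w = ⊤
Covers (suc k) w = Covers k w × T (occurs k w)

StopFree : Vec ℕ n → Set
StopFree []      = ⊤
StopFree (y ∷ w) = threshold w ≤ y × StopFree w

Bounded-irrelevant : ∀ k (w : Vec ℕ n) → Irrelevant (Bounded k w)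
Bounded-irrelevant k []      _         _         = refl
Bounded-irrelevant k (y ∷ w) (p , ps) (q , qs) = cong₂ _,_ (<-irrelevant p q) (Bounded-irrelevant k w ps qs)

Covers-irrelevant : ∀ k (w : Vec ℕ n) → Irrelevant (Covers k w)
Covers-irrelevant zero    w _        _        = refl
Covers-irrelevant (suc k) w (p , o) (q , o′) = cong₂ _,_ (Covers-irrelevant k w p q) (T-irrelevant o o′)

StopFree-irrelevant : ∀ (w : Vec ℕ n) → Irrelevant (StopFree w)
StopFree-irrelevant []      _        _        = refl
StopFree-irrelevant (y ∷ w) (p , ps) (q , qs) = cong₂ _,_ (≤-irrelevant p q) (StopFree-irrelevant w ps qs)

occurs-here : ∀ y (w : Vec ℕ n) → T (occurs y (y ∷ w))
occurs-here y w with y ≟ y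
... | yes _   = tt
... | no  y≢y = ⊥-elim (y≢y refl)

occurs-there : ∀ {v} y (w : Vec ℕ n) → T (occurs v w) → T (occurs v (y ∷ w))
occurs-there {v = v} y w o with v ≟ y
... | yes _ = tt
... | no  _ = o

occurs-∷⁻ : ∀ {v} y (w : Vec ℕ n) → T (occurs v (y ∷ w)) → v ≡ y ⊎ T (occurs v w)
occurs-∷⁻ {v = v} y w o with v ≟ y
... | yes v≡y = inj₁ v≡y
... | no  _   = inj₂ o

someAtLeast-∷⁺ : ∀ {x} y (w : Vec ℕ n) → x ≤ y ⊎ T (someAtLeast x w) → T (someAtLeast x (y ∷ w))
someAtLeast-∷⁺ {x = x} y w p with x ≤? y | p
... | yes _   | _         = tt
... | no  x≰y | inj₁ x≤y  = ⊥-elim (x≰y x≤y)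
... | no  _   | inj₂ some = some

someAtLeast-∷⁻ : ∀ {x} y (w : Vec ℕ n) → T (someAtLeast x (y ∷ w)) → x ≤ y ⊎ T (someAtLeast x w)
someAtLeast-∷⁻ {x = x} y w some with x ≤? y
... | yes x≤y = inj₁ x≤y
... | no  _   = inj₂ some

occurs-shift : ∀ x v (w : Vec ℕ n) → occurs (shift x v) (map (shift x) w) ≡ occurs v w
occurs-shift x v []      = refl
occurs-shift x v (y ∷ w) with shift x v ≟ shift x y | v ≟ y
... | yes _     | yes _    = refl
... | yes sv≡sy | no  v≢y  = ⊥-elim (v≢y (shift-injective x sv≡sy))
... | no  sv≢sy | yes refl = ⊥-elim (sv≢sy refl)
... | no  _     | no  _    = occurs-shift x v w

occurs-self-shift : ∀ x (w : Vec ℕ n) → occurs x (map (shift x) w) ≡ false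
occurs-self-shift x []      = refl
occurs-self-shift x (y ∷ w) with x ≟ shift x y
... | yes x≡sy = ⊥-elim (shift≢ x y (sym x≡sy))
... | no  _    = occurs-self-shift x w

someAtLeast-shift : ∀ x y (w : Vec ℕ n) → someAtLeast (suc (shift x y)) (map (shift x) w) ≡ someAtLeast (suc y) w
someAtLeast-shift x y []      = refl
someAtLeast-shift x y (z ∷ w) with suc (shift x y) ≤? shift x z | suc y ≤? z
... | yes _     | yes _   = refl
... | yes sy<sz | no  y≮z = ⊥-elim (y≮z (shift-cancel-< x sy<sz))
... | no  sy≮sz | yes y<z = ⊥-elim (sy≮sz (shift-mono-< x y<z))
... | no  _     | no  _   = someAtLeast-shift x y w

someAtLeast-self-shift : ∀ x (w : Vec ℕ n) → someAtLeast (suc x) (map (shift x) w) ≡ someAtLeast x w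
someAtLeast-self-shift x []      = refl
someAtLeast-self-shift x (z ∷ w) with suc x ≤? shift x z | x ≤? z
... | yes _     | yes _   = refl
... | yes x<sz  | no  x≰z = ⊥-elim (x≰z (Equivalence.from (≤⇔<shift x z) x<sz))
... | no  x≮sz  | yes x≤z = ⊥-elim (x≮sz (Equivalence.to (≤⇔<shift x z) x≤z))
... | no  _     | no  _   = someAtLeast-self-shift x w

shiftThreshold : ℕ → ℕ → ℕ
shiftThreshold x zero    = zero
shiftThreshold x (suc v) = suc (shift x v)

threshold-shift : ∀ x (w : Vec ℕ n) → threshold (map (shift x) w) ≡ shiftThreshold x (threshold w)
threshold-shift x []      = refl
threshold-shift x (y ∷ w) rewrite someAtLeast-shift x y w with someAtLeast (suc y) w
... | true  = refl
... | false = threshold-shift x w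

shiftThreshold-≤⇔ : ∀ x t y → shiftThreshold x t ≤ shift x y ⇔ t ≤ y
shiftThreshold-≤⇔ x zero    y = mk⇔ (λ _ → z≤n) (λ _ → z≤n)
shiftThreshold-≤⇔ x (suc t) y = mk⇔ (shift-cancel-< x) (shift-mono-< x)

shiftThreshold-≤ : ∀ x t → t ≤ x → shiftThreshold x t ≡ t
shiftThreshold-≤ x zero    _   = refl
shiftThreshold-≤ x (suc t) t<x = cong suc (shift-< t<x)

≤-shiftThreshold : ∀ x t → t ≤ shiftThreshold x t
≤-shiftThreshold x zero    = z≤n
≤-shiftThreshold x (suc t) = s≤s (≤-shift t)
  where
  ≤-shift : ∀ v → v ≤ shift x v
  ≤-shift v with v <? x
  ... | yes _ = ≤-refl
  ... | no  _ = n≤1+n v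

stopFree-shift : ∀ x (w : Vec ℕ n) → StopFree (map (shift x) w) ⇔ StopFree w
stopFree-shift x []      = mk⇔ _ _
stopFree-shift x (y ∷ w) rewrite threshold-shift x w =
  mk⇔ (λ (t≤y , sf) → Equivalence.to (shiftThreshold-≤⇔ x _ y) t≤y , Equivalence.to (stopFree-shift x w) sf)
      (λ (t≤y , sf) → Equivalence.from (shiftThreshold-≤⇔ x _ y) t≤y , Equivalence.from (stopFree-shift x w) sf)

bounded-shift : ∀ {x k} (w : Vec ℕ n) → x ≤ k → Bounded (suc k) (map (shift x) w) ⇔ Bounded k w
bounded-shift []      _   = mk⇔ _ _
bounded-shift {x = x} {k} (y ∷ w) x≤k =
  mk⇔ (λ (y< , b) → to y< , Equivalence.to (bounded-shift w x≤k) b)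
      (λ (y< , b) → from y< , Equivalence.from (bounded-shift w x≤k) b)
  where
  to : shift x y < suc k → y < k
  to sy<1+k with y <? x
  ... | yes y<x = <-≤-trans y<x x≤k
  ... | no  _   = ≤-pred sy<1+k
  from : y < k → shift x y < suc k
  from y<k with y <? x
  ... | yes _ = m<n⇒m<1+n y<k
  ... | no  _ = s≤s y<k

map-unshift-shift : ∀ x (w : Vec ℕ n) → map (unshift x) (map (shift x) w) ≡ w
map-unshift-shift x []      = refl
map-unshift-shift x (y ∷ w) = cong₂ _∷_ (unshift-shift x y) (map-unshift-shift x w)

map-shift-unshift : ∀ x (w : Vec ℕ n) → occurs x w ≡ false → map (shift x) (map (unshift x) w) ≡ w
map-shift-unshift x []      _ = refl
map-shift-unshift x (y ∷ w) o with x ≟ y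
... | no x≢y = cong₂ _∷_ (shift-unshift x y (x≢y ∘ sym)) (map-shift-unshift x w o)

covers-elim : ∀ {k j} {w : Vec ℕ n} → Covers k w → j < k → T (occurs j w)
covers-elim {k = suc k} {j} (c , o) j<1+k with m≤n⇒m<n∨m≡n (≤-pred j<1+k)
... | inj₁ j<k  = covers-elim c j<k
... | inj₂ refl = o

covers-intro : ∀ k {w : Vec ℕ n} → (∀ {j} → j < k → T (occurs j w)) → Covers k w
covers-intro zero    _   = tt
covers-intro (suc k) occ = covers-intro k (occ ∘ m<n⇒m<1+n) , occ ≤-refl

covers-∷ : ∀ {k} y (w : Vec ℕ n) → Covers k w → Covers k (y ∷ w)
covers-∷ {k = k} y w c = covers-intro k (occurs-there y w ∘ covers-elim c)

covers-∷⁻ : ∀ {k} y (w : Vec ℕ n) → Covers k (y ∷ w) → T (occurs y w) → Covers k w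
covers-∷⁻ {k = k} y w c o = covers-intro k occ
  where
  occ : ∀ {j} → j < k → T (occurs j w)
  occ {j} j<k with occurs-∷⁻ {v = j} y w (covers-elim c j<k)
  ... | inj₁ refl = o
  ... | inj₂ o′   = o′

covers-openBlock : ∀ {k} x (w : Vec ℕ n) → x ≤ k → Covers k w → Covers (suc k) (x ∷ map (shift x) w)
covers-openBlock {k = k} x w x≤k c = covers-intro (suc k) occ
  where
  occ : ∀ {j} → j < suc k → T (occurs j (x ∷ map (shift x) w))
  occ {j} j<1+k with j ≟ x
  ... | yes _   = tt
  ... | no  j≢x = subst (λ v → T (occurs v (map (shift x) w))) (shift-unshift x j j≢x)
                        (subst T (sym (occurs-shift x (unshift x j) w)) (covers-elim c (unshift< j<1+k j≢x)))
    where
    unshift< : ∀ {j} → j < suc k → j ≢ x → unshift x j < k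
    unshift< {j} j<1+k j≢x with j <? x
    ... | yes j<x = <-≤-trans j<x x≤k
    unshift< {zero}  j<1+k j≢x | no j≮x = ⊥-elim (j≢x (sym (n≤0⇒n≡0 (≮⇒≥ j≮x))))
    unshift< {suc j} j<1+k j≢x | no j≮x = ≤-pred j<1+k

covers-openBlock⁻ : ∀ {k} x (w : Vec ℕ n) → Covers (suc k) (x ∷ map (shift x) w) → Covers k w
covers-openBlock⁻ {k = k} x w c = covers-intro k occ
  where
  shift< : ∀ {i} → i < k → shift x i < suc k
  shift< {i} i<k with i <? x
  ... | yes _ = m<n⇒m<1+n i<k
  ... | no  _ = s≤s i<k
  occ : ∀ {i} → i < k → T (occurs i w)
  occ {i} i<k with occurs-∷⁻ x _ (covers-elim c (shift< i<k))
  ... | inj₁ si≡x = ⊥-elim (shift≢ x i si≡x)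
  ... | inj₂ o    = subst T (occurs-shift x i w) o

occurs⇒someAtLeast : ∀ {x z} (w : Vec ℕ n) → T (occurs z w) → x ≤ z → T (someAtLeast x w)
occurs⇒someAtLeast {x = x} {z} (y ∷ w) o x≤z with occurs-∷⁻ {v = z} y w o
... | inj₁ refl = someAtLeast-∷⁺ y w (inj₁ x≤z)
... | inj₂ o′   = someAtLeast-∷⁺ y w (inj₂ (occurs⇒someAtLeast w o′ x≤z))

someAtLeast⇒< : ∀ {x k} (w : Vec ℕ n) → T (someAtLeast x w) → Bounded k w → x < k
someAtLeast⇒< (y ∷ w) some (y<k , b) with someAtLeast-∷⁻ y w some
... | inj₁ x≤y   = ≤-<-trans x≤y y<k
... | inj₂ some′ = someAtLeast⇒< w some′ b

someAtLeast-covered : ∀ {k} x (w : Vec ℕ n) → Bounded k w → Covers k w → someAtLeast x w ≡ ⌊ x <? k ⌋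
someAtLeast-covered {k = k} x w b c with x <? k
... | yes x<k = Equivalence.to T-≡ (occurs⇒someAtLeast w (covers-elim c (pred< x<k)) (≤pred x<k))
  where
  pred< : ∀ {x k} → x < k → pred k < k
  pred< (s≤s _) = ≤-refl
  ≤pred : ∀ {x k} → x < k → x ≤ pred k
  ≤pred (s≤s x≤k) = x≤k
... | no  x≮k with someAtLeast x w in eq
...   | true  = ⊥-elim (x≮k (someAtLeast⇒< w (subst T (sym eq) tt) b))
...   | false = refl

threshold≤ : ∀ {k} (w : Vec ℕ n) → Bounded k w → threshold w ≤ k
threshold≤ []      _         = z≤n
threshold≤ (y ∷ w) (y<k , b) with someAtLeast (suc y) w
... | true  = y<k
... | false = threshold≤ w b

Valid : ℕ → Vec ℕ n → Set
Valid k w = Bounded k w × Covers k w × StopFree w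

ActiveWord : ℕ → Set
ActiveWord n = Σ ℕ λ k → Σ (Vec ℕ n) (Valid k)

Valid-irrelevant : ∀ k (w : Vec ℕ n) → Irrelevant (Valid k w)
Valid-irrelevant k w (b , c , s) (b′ , c′ , s′) =
  cong₂ _,_ (Bounded-irrelevant k w b b′) (cong₂ _,_ (Covers-irrelevant k w c c′) (StopFree-irrelevant w s s′))

ActiveWord-≡ : ∀ {k} {w w′ : Vec ℕ n} {v : Valid k w} {v′ : Valid k w′} → w ≡ w′ →
               _≡_ {A = ActiveWord n} (k , w , v) (k , w′ , v′)
ActiveWord-≡ {k = k} {w} refl = cong (λ v → k , w , v) (Valid-irrelevant k w _ _)

-- inj₁ x: the new first letter joins the existing block x; inj₂ x: it opens a new block x.
Insertion : ℕ → ℕ → Set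
Insertion k t = (Σ ℕ λ x → t ≤ x × x < k) ⊎ (Σ ℕ λ x → t ≤ x × x ≤ k)

insertionOf : ActiveWord n → Set
insertionOf (k , w , _) = Insertion k (threshold w)

labelAfter : ∀ k t → Insertion k t → ℕ
labelAfter k t (inj₁ (x , _)) = k ∸ (if ⌊ suc x <? k ⌋ then suc x else t)
labelAfter k t (inj₂ (x , _)) = suc k ∸ (if ⌊ x <? k ⌋ then suc x else t)

wordLabel : ActiveWord n → ℕ
wordLabel (k , w , _) = k ∸ threshold w

threshold-openBlock : ∀ x (w : Vec ℕ n) → threshold w ≤ x → threshold (map (shift x) w) ≡ threshold w
threshold-openBlock x w t≤x = trans (threshold-shift x w) (shiftThreshold-≤ x _ t≤x)

prepend : Σ (ActiveWord n) insertionOf → ActiveWord (suc n)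
prepend ((k , w , b , c , s) , inj₁ (x , t≤x , x<k)) = k , x ∷ w , (x<k , b) , covers-∷ x w c , (t≤x , s)
prepend ((k , w , b , c , s) , inj₂ (x , t≤x , x≤k)) =
  suc k , x ∷ map (shift x) w , (s≤s x≤k , Equivalence.from (bounded-shift w x≤k) b) , covers-openBlock x w x≤k c ,
  (subst (_≤ x) (sym (threshold-openBlock x w t≤x)) t≤x , Equivalence.from (stopFree-shift x w) s)

-- occurs x w is passed together with its defining equation so that proofs can case on it without
-- abstracting occurs x w inside the validity proofs.
dropFirstWith : ∀ k x (w : Vec ℕ n) → Valid k (x ∷ w) → (o : Bool) → occurs x w ≡ o →
                Σ (ActiveWord n) insertionOf
dropFirstWith zero    x w ((() , _) , _)
dropFirstWith (suc k) x w ((x<1+k , b) , c , (t≤x , s)) true occ =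
  (suc k , w , b , covers-∷⁻ x w c (subst T (sym occ) tt) , s) , inj₁ (x , t≤x , x<1+k)
dropFirstWith (suc k) x w ((x<1+k , b) , c , (t≤x , s)) false occ =
  (k , w′ , b′ , c′ , s′) , inj₂ (x , t′≤x , ≤-pred x<1+k)
  where
  w′ : Vec ℕ _
  w′ = map (unshift x) w
  w≡ : map (shift x) w′ ≡ w
  w≡ = map-shift-unshift x w occ
  b′ : Bounded k w′
  b′ = Equivalence.to (bounded-shift w′ (≤-pred x<1+k)) (subst (Bounded (suc k)) (sym w≡) b)
  c′ : Covers k w′
  c′ = covers-openBlock⁻ x w′ (subst (λ v → Covers (suc k) (x ∷ v)) (sym w≡) c)
  s′ : StopFree w′
  s′ = Equivalence.to (stopFree-shift x w′) (subst StopFree (sym w≡) s)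
  t′≤x : threshold w′ ≤ x
  t′≤x = ≤-trans (≤-shiftThreshold x _)
                 (subst (_≤ x) (trans (cong threshold (sym w≡)) (threshold-shift x w′)) t≤x)

dropFirst : ActiveWord (suc n) → Σ (ActiveWord n) insertionOf
dropFirst (k , x ∷ w , v) = dropFirstWith k x w v (occurs x w) refl

prepended-≡ : ∀ {k x} {w w′ : Vec ℕ n} {v : Valid k w} {v′ : Valid k w′} {p q p′ q′} → w ≡ w′ →
              _≡_ {A = Σ (ActiveWord n) insertionOf}
                  ((k , w , v) , inj₂ (x , p , q)) ((k , w′ , v′) , inj₂ (x , p′ , q′))
prepended-≡ {k = k} {x} {w} refl =
  cong₂ (λ v pq → (k , w , v) , inj₂ (x , pq)) (Valid-irrelevant k w _ _)
        (cong₂ _,_ (≤-irrelevant _ _) (≤-irrelevant _ _))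

dropFirst∘prepend : ∀ (z : Σ (ActiveWord n) insertionOf) → dropFirst (prepend z) ≡ z
dropFirst∘prepend ((k , w , b , c , s) , inj₁ (x , t≤x , x<k)) = go k x<k b c (occurs x w) refl
  where
  go : ∀ k (x<k : x < k) b c o occ →
       dropFirstWith k x w ((x<k , b) , covers-∷ x w c , (t≤x , s)) o occ ≡
       ((k , w , b , c , s) , inj₁ (x , t≤x , x<k))
  go (suc k) x<k b c true  occ =
    cong (λ c → (suc k , w , b , c , s) , inj₁ (x , t≤x , x<k)) (Covers-irrelevant (suc k) w _ _)
  go (suc k) x<k b c false occ = ⊥-elim (subst T occ (covers-elim c x<k))
dropFirst∘prepend ((k , w , v) , inj₂ (x , t≤x , x≤k)) = go (occurs x (map (shift x) w)) refl
  where
  go : ∀ {v′} o occ → dropFirstWith (suc k) x (map (shift x) w) v′ o occ ≡ ((k , w , v) , inj₂ (x , t≤x , x≤k))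
  go true  occ = ⊥-elim (subst T (trans (sym occ) (occurs-self-shift x w)) tt)
  go false occ = prepended-≡ (map-unshift-shift x w)

prepend∘dropFirst : ∀ (a : ActiveWord (suc n)) → prepend (dropFirst a) ≡ a
prepend∘dropFirst (k , x ∷ w , v) = go k v (occurs x w) refl
  where
  go : ∀ k v o occ → prepend (dropFirstWith k x w v o occ) ≡ (k , x ∷ w , v)
  go zero    ((() , _) , _)
  go (suc k) v true  occ = ActiveWord-≡ refl
  go (suc k) v false occ = ActiveWord-≡ (cong (x ∷_) (map-shift-unshift x w occ))

wordLabel-prepend : ∀ k (w : Vec ℕ n) v i → wordLabel (prepend ((k , w , v) , i)) ≡ labelAfter k (threshold w) i
wordLabel-prepend k w (b , c , _) (inj₁ (x , _ , _))
  rewrite someAtLeast-covered (suc x) w b c = refl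
wordLabel-prepend k w (b , c , _) (inj₂ (x , t≤x , _))
  rewrite someAtLeast-self-shift x w | someAtLeast-covered x w b c | threshold-openBlock x w t≤x = refl

module _ {k t : ℕ} (t≤k : t ≤ k) where

  private
    t+j<k : ∀ {j} → j < k ∸ t → t + j < k
    t+j<k j<d = subst (_ <_) (m+[n∸m]≡n t≤k) (+-monoʳ-< t j<d)

  -- With d = k ∸ t: joining block x < k − 1 leads to label k − (x + 1) = d − (x − t + 1), joining the
  -- last block keeps d, a new block x < k leads to k − x = d − (x − t), and a new last block to d + 1.
  toChild : Insertion k t → SchroederChild (k ∸ t)
  toChild (inj₁ (x , t≤x , x<k)) with suc x <? k
  ... | yes 1+x<k =
    inj₂ (true , suc (x ∸ t) , subst (_< k ∸ t) (+-∸-assoc 1 t≤x) (∸-monoˡ-< 1+x<k (m≤n⇒m≤1+n t≤x)))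
  ... | no  _     = inj₂ (true , 0 , m<n⇒0<n∸m (≤-<-trans t≤x x<k))
  toChild (inj₂ (x , t≤x , x≤k)) with x <? k
  ... | yes x<k = inj₂ (false , x ∸ t , ∸-monoˡ-< x<k t≤x)
  ... | no  _   = inj₁ tt

  fromChild : SchroederChild (k ∸ t) → Insertion k t
  fromChild (inj₁ _)                     = inj₂ (k , t≤k , ≤-refl)
  fromChild (inj₂ (false , j , j<d))     = inj₂ (t + j , m≤m+n t j , <⇒≤ (t+j<k j<d))
  fromChild (inj₂ (true  , zero , 0<d))  = inj₁ (pred k , <⇒≤pred t<k , pred< t<k)
    where
    t<k : t < k
    t<k = m∸n≢0⇒n<m (>⇒≢ 0<d)
    pred< : ∀ {t k} → t < k → pred k < k
    pred< (s≤s _) = ≤-refl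
  fromChild (inj₂ (true  , suc j , j<d)) =
    inj₁ (t + j , m≤m+n t j , <-trans (n<1+n (t + j)) (subst (_< k) (+-suc t j) (t+j<k j<d)))

  private
    existing-≡ : ∀ {x x′ p p′ q q′} → x ≡ x′ → _≡_ {A = Insertion k t} (inj₁ (x , p , q)) (inj₁ (x′ , p′ , q′))
    existing-≡ refl = cong (λ pq → inj₁ (_ , pq)) (cong₂ _,_ (≤-irrelevant _ _) (<-irrelevant _ _))
    new-≡ : ∀ {x x′ p p′ q q′} → x ≡ x′ → _≡_ {A = Insertion k t} (inj₂ (x , p , q)) (inj₂ (x′ , p′ , q′))
    new-≡ refl = cong (λ pq → inj₂ (_ , pq)) (cong₂ _,_ (≤-irrelevant _ _) (≤-irrelevant _ _))
    child-≡ : ∀ {b j j′ p p′} → j ≡ j′ → _≡_ {A = SchroederChild (k ∸ t)} (inj₂ (b , j , p)) (inj₂ (b , j′ , p′))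
    child-≡ refl = cong (λ p → inj₂ (_ , _ , p)) (<-irrelevant _ _)

  toChild∘fromChild : ∀ c → toChild (fromChild c) ≡ c
  toChild∘fromChild (inj₁ tt) with k <? k
  ... | yes k<k = ⊥-elim (<-irrefl refl k<k)
  ... | no  _   = refl
  toChild∘fromChild (inj₂ (false , j , j<d)) with t + j <? k
  ... | yes _     = child-≡ (m+n∸m≡n t j)
  ... | no  t+j≮k = ⊥-elim (t+j≮k (t+j<k j<d))
  toChild∘fromChild (inj₂ (true , zero , 0<d)) with suc (pred k) <? k
  ... | yes k<k = ⊥-elim (1+pred≮ k k<k)
    where
    1+pred≮ : ∀ k → ¬ suc (pred k) < k
    1+pred≮ (suc k) = <-irrefl refl
  ... | no  _   = child-≡ refl
  toChild∘fromChild (inj₂ (true , suc j , j<d)) with suc (t + j) <? k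
  ... | yes _     = child-≡ (cong suc (m+n∸m≡n t j))
  ... | no  t+j≮k = ⊥-elim (t+j≮k (subst (_< k) (+-suc t j) (t+j<k j<d)))

  fromChild∘toChild : ∀ i → fromChild (toChild i) ≡ i
  fromChild∘toChild (inj₁ (x , t≤x , x<k)) with suc x <? k
  ... | yes _     = existing-≡ (m+[n∸m]≡n t≤x)
  ... | no  1+x≮k = existing-≡ (pred-last x<k 1+x≮k)
    where
    pred-last : ∀ {x k} → x < k → ¬ suc x < k → pred k ≡ x
    pred-last {k = suc k} (s≤s x≤k) 1+x≮k = ≤-antisym (≮⇒≥ (1+x≮k ∘ s≤s)) x≤k
  fromChild∘toChild (inj₂ (x , t≤x , x≤k)) with x <? k
  ... | yes _   = new-≡ (m+[n∸m]≡n t≤x)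
  ... | no  x≮k = new-≡ (≤-antisym (≮⇒≥ x≮k) x≤k)

  insertion↔child : Insertion k t ↔ SchroederChild (k ∸ t)
  insertion↔child = mk↔ₛ′ toChild fromChild toChild∘fromChild fromChild∘toChild

  childLabel-toChild : ∀ i → childLabel (k ∸ t) (toChild i) ≡ labelAfter k t i
  childLabel-toChild (inj₁ (x , t≤x , _)) with suc x <? k
  ... | yes _ =
    trans (∸-+-assoc k t (suc (x ∸ t))) (cong (k ∸_) (trans (+-suc t (x ∸ t)) (cong suc (m+[n∸m]≡n t≤x))))
  ... | no  _ = refl
  childLabel-toChild (inj₂ (x , t≤x , _)) with x <? k
  ... | yes _ = trans (∸-+-assoc k t (x ∸ t)) (cong (k ∸_) (m+[n∸m]≡n t≤x))
  ... | no  _ = sym (+-∸-assoc 1 t≤k)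

activeWord-zero : ActiveWord 0 ↔ ⊤
activeWord-zero = mk↔ₛ′ _ (λ _ → 0 , [] , _) (λ _ → refl) from∘to
  where
  from∘to : ∀ a → (0 , [] , _) ≡ a
  from∘to (zero  , [] , _)             = refl
  from∘to (suc k , [] , _ , (_ , ()) , _)

insertionOf↔child : ∀ {n} (a : ActiveWord n) → insertionOf a ↔ SchroederChild (wordLabel a)
insertionOf↔child (k , w , b , _) = insertion↔child (threshold≤ w b)

activeWordGrowth : SchroederGrowth ActiveWord
activeWordGrowth = record
  { label      = wordLabel
  ; root       = activeWord-zero
  ; label-root = refl
  ; grow       = ↔-trans (mk↔ₛ′ dropFirst prepend dropFirst∘prepend prepend∘dropFirst)
                         (Σ-↔ ↔-refl λ {a} → insertionOf↔child a)
  ; label-grow = label-grow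
  }
  where
  label-grow : ∀ {n} (a : ActiveWord n) c →
               wordLabel (prepend (a , Inverse.from (insertionOf↔child a) c)) ≡ childLabel (wordLabel a) c
  label-grow a@(k , w , v@(b , _)) c = begin
    wordLabel (prepend (a , fromChild t≤k c))                 ≡⟨ wordLabel-prepend k w v (fromChild t≤k c) ⟩
    labelAfter k (threshold w) (fromChild t≤k c)              ≡⟨ childLabel-toChild t≤k (fromChild t≤k c) ⟨
    childLabel (wordLabel a) (toChild t≤k (fromChild t≤k c))  ≡⟨ cong (childLabel (wordLabel a)) (toChild∘fromChild t≤k c) ⟩
    childLabel (wordLabel a) c                                ∎
    where
    open ≡-Reasoning
    t≤k : threshold w ≤ k
    t≤k = threshold≤ w b

-- Stopping patterns

occurs⇒lookup : ∀ {v} (w : Vec ℕ n) → T (occurs v w) → Σ (Fin n) λ i → lookup w i ≡ v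
occurs⇒lookup {v = v} (y ∷ w) o with occurs-∷⁻ {v = v} y w o
... | inj₁ v≡y = fzero , sym v≡y
... | inj₂ o′  = let i , wᵢ≡v = occurs⇒lookup w o′ in fsuc i , wᵢ≡v

lookup⇒occurs : ∀ {v} (w : Vec ℕ n) (i : Fin n) → lookup w i ≡ v → T (occurs v w)
lookup⇒occurs (y ∷ w) fzero    refl = occurs-here y w
lookup⇒occurs (y ∷ w) (fsuc i) wᵢ≡v = occurs-there y w (lookup⇒occurs w i wᵢ≡v)

someAtLeast⇒lookup : ∀ {x} (w : Vec ℕ n) → T (someAtLeast x w) → Σ (Fin n) λ i → x ≤ lookup w i
someAtLeast⇒lookup (y ∷ w) some with someAtLeast-∷⁻ y w some
... | inj₁ x≤y   = fzero , x≤y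
... | inj₂ some′ = let i , x≤wᵢ = someAtLeast⇒lookup w some′ in fsuc i , x≤wᵢ

lookup⇒someAtLeast : ∀ {x} (w : Vec ℕ n) (i : Fin n) → x ≤ lookup w i → T (someAtLeast x w)
lookup⇒someAtLeast (y ∷ w) fzero    x≤y  = someAtLeast-∷⁺ y w (inj₁ x≤y)
lookup⇒someAtLeast (y ∷ w) (fsuc i) x≤wᵢ = someAtLeast-∷⁺ y w (inj₂ (lookup⇒someAtLeast w i x≤wᵢ))

HasStop : Vec ℕ n → Set
HasStop {n} w = Σ (Fin n) λ i₁ → Σ (Fin n) λ i₂ → Σ (Fin n) λ i₃ →
  toℕ i₁ < toℕ i₂ × toℕ i₂ < toℕ i₃ × lookup w i₁ ≤ lookup w i₂ × lookup w i₂ < lookup w i₃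

StopAbove : ℕ → Vec ℕ n → Set
StopAbove {n} y w = Σ (Fin n) λ i₂ → Σ (Fin n) λ i₃ →
  toℕ i₂ < toℕ i₃ × y ≤ lookup w i₂ × lookup w i₂ < lookup w i₃

hasStop-∷⁻ : ∀ y (w : Vec ℕ n) → HasStop (y ∷ w) → StopAbove y w ⊎ HasStop w
hasStop-∷⁻ y w (fzero  , fsuc i₂ , fsuc i₃ , _ , i₂<i₃ , p , q) =
  inj₁ (i₂ , i₃ , s≤s⁻¹ i₂<i₃ , p , q)
hasStop-∷⁻ y w (fsuc i₁ , fsuc i₂ , fsuc i₃ , i₁<i₂ , i₂<i₃ , p , q) =
  inj₂ (i₁ , i₂ , i₃ , s≤s⁻¹ i₁<i₂ , s≤s⁻¹ i₂<i₃ , p , q)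
hasStop-∷⁻ y w (_ , fzero , _ , () , _)
hasStop-∷⁻ y w (_ , fsuc _ , fzero , _ , () , _)

hasStop-∷⁺ : ∀ y (w : Vec ℕ n) → StopAbove y w ⊎ HasStop w → HasStop (y ∷ w)
hasStop-∷⁺ y w (inj₁ (i₂ , i₃ , i₂<i₃ , p , q)) =
  fzero , fsuc i₂ , fsuc i₃ , s≤s z≤n , s≤s i₂<i₃ , p , q
hasStop-∷⁺ y w (inj₂ (i₁ , i₂ , i₃ , i₁<i₂ , i₂<i₃ , p , q)) =
  fsuc i₁ , fsuc i₂ , fsuc i₃ , s≤s i₁<i₂ , s≤s i₂<i₃ , p , q

stopAbove-∷⁻ : ∀ {y} z (w : Vec ℕ n) → StopAbove y (z ∷ w) → y ≤ z × T (someAtLeast (suc z) w) ⊎ StopAbove y w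
stopAbove-∷⁻ z w (fzero  , fsuc i₃ , _ , p , q)           = inj₁ (p , lookup⇒someAtLeast w i₃ q)
stopAbove-∷⁻ z w (fsuc i₂ , fsuc i₃ , i₂<i₃ , p , q)      = inj₂ (i₂ , i₃ , s≤s⁻¹ i₂<i₃ , p , q)
stopAbove-∷⁻ z w (_ , fzero , () , _)

stopAbove⇔<threshold : ∀ {y} (w : Vec ℕ n) → StopFree w → StopAbove y w ⇔ y < threshold w
stopAbove⇔<threshold w s = mk⇔ (to w s) (from w s)
  where
  to : ∀ {n y} (w : Vec ℕ n) → StopFree w → StopAbove y w → y < threshold w
  to (z ∷ w) (t≤z , s) st with someAtLeast (suc z) w | stopAbove-∷⁻ z w st
  ... | true  | inj₁ (y≤z , _) = s≤s y≤z
  ... | true  | inj₂ st′       = <-≤-trans (to w s st′) (m≤n⇒m≤1+n t≤z)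
  ... | false | inj₁ (_ , ())
  ... | false | inj₂ st′       = to w s st′
  from : ∀ {n y} (w : Vec ℕ n) → StopFree w → y < threshold w → StopAbove y w
  from (z ∷ w) (_ , s) y<t with someAtLeast (suc z) w in some
  ... | true  = let i₃ , q = someAtLeast⇒lookup w (subst T (sym some) tt)
                in fzero , fsuc i₃ , s≤s z≤n , ≤-pred y<t , q
  ... | false = let i₂ , i₃ , i₂<i₃ , p , q = from w s y<t in fsuc i₂ , fsuc i₃ , s≤s i₂<i₃ , p , q

stopFree⇔¬hasStop : ∀ (w : Vec ℕ n) → StopFree w ⇔ (¬ HasStop w)
stopFree⇔¬hasStop w = mk⇔ (to w) (from w)
  where
  to : ∀ {n} (w : Vec ℕ n) → StopFree w → ¬ HasStop w
  to (y ∷ w) (t≤y , s) st with hasStop-∷⁻ y w st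
  ... | inj₁ above = <⇒≱ (Equivalence.to (stopAbove⇔<threshold w s) above) t≤y
  ... | inj₂ st′   = to w s st′
  from : ∀ {n} (w : Vec ℕ n) → ¬ HasStop w → StopFree w
  from []      _       = tt
  from (y ∷ w) ¬stop = ≮⇒≥ (¬stop ∘ hasStop-∷⁺ y w ∘ inj₁ ∘ Equivalence.from (stopAbove⇔<threshold w s)) , s
    where
    s : StopFree w
    s = from w (¬stop ∘ hasStop-∷⁺ y w ∘ inj₂)

fromBounded : (w : Vec ℕ n) → Bounded k w → Vec (Fin k) n
fromBounded []      _         = []
fromBounded (y ∷ w) (y<k , b) = fromℕ< y<k ∷ fromBounded w b

map-toℕ-fromBounded : (w : Vec ℕ n) (b : Bounded k w) → map toℕ (fromBounded w b) ≡ w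
map-toℕ-fromBounded []      _       = refl
map-toℕ-fromBounded (y ∷ w) (_ , b) = cong₂ _∷_ (toℕ-fromℕ< _) (map-toℕ-fromBounded w b)

fromBounded-map-toℕ : (r : Vec (Fin k) n) (b : Bounded k (map toℕ r)) → fromBounded (map toℕ r) b ≡ r
fromBounded-map-toℕ []      _       = refl
fromBounded-map-toℕ (j ∷ r) (_ , b) = cong₂ _∷_ (fromℕ<-toℕ j _) (fromBounded-map-toℕ r b)

bounded-map-toℕ : (r : Vec (Fin k) n) → Bounded k (map toℕ r)
bounded-map-toℕ []      = _
bounded-map-toℕ (j ∷ r) = toℕ<n j , bounded-map-toℕ r

covers⇔surjective : (r : Vec (Fin k) n) → Covers k (map toℕ r) ⇔ Surjective r
covers⇔surjective {k} r = mk⇔ to from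
  where
  to : Covers k (map toℕ r) → Surjective r
  to c j = let i , rᵢ≡j = occurs⇒lookup (map toℕ r) (covers-elim c (toℕ<n j))
           in i , toℕ-injective (trans (sym (lookup-map i toℕ r)) rᵢ≡j)
  from : Surjective r → Covers k (map toℕ r)
  from surj = covers-intro k λ {j} j<k → let i , rᵢ≡j = surj (fromℕ< j<k)
              in lookup⇒occurs (map toℕ r) i (trans (lookup-map i toℕ r) (trans (cong toℕ rᵢ≡j) (toℕ-fromℕ< j<k)))

hasStop⇔containsStop : (r : Vec (Fin k) n) → HasStop (map toℕ r) ⇔ ContainsStop r
hasStop⇔containsStop r = mk⇔
  (λ (i₁ , i₂ , i₃ , i₁<i₂ , i₂<i₃ , p , q) →
     i₁ , i₂ , i₃ , i₁<i₂ , i₂<i₃ , subst₂ _≤_ (ℓ i₁) (ℓ i₂) p , subst₂ _<_ (ℓ i₂) (ℓ i₃) q)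
  (λ (i₁ , i₂ , i₃ , i₁<i₂ , i₂<i₃ , p , q) →
     i₁ , i₂ , i₃ , i₁<i₂ , i₂<i₃ , subst₂ _≤_ (sym (ℓ i₁)) (sym (ℓ i₂)) p , subst₂ _<_ (sym (ℓ i₂)) (sym (ℓ i₃)) q)
  where
  ℓ : ∀ i → lookup (map toℕ r) i ≡ toℕ (lookup r i)
  ℓ i = lookup-map i toℕ r

active↔activeWord : ∀ n → Active n ↔ ActiveWord n
active↔activeWord n = mk↔ₛ′ to from to∘from from∘to
  where
  to : Active n → ActiveWord n
  to (k , r , surj , noStop) =
    k , map toℕ r , bounded-map-toℕ r ,
    Equivalence.from (covers⇔surjective r) (toWitness surj) ,
    Equivalence.from (stopFree⇔¬hasStop (map toℕ r)) (toWitnessFalse noStop ∘ Equivalence.to (hasStop⇔containsStop r))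
  from : ActiveWord n → Active n
  from (k , w , b , c , s) =
    k , r , fromWitness (Equivalence.to (covers⇔surjective r) c′) ,
    fromWitnessFalse (Equivalence.to (stopFree⇔¬hasStop (map toℕ r)) s′ ∘ Equivalence.from (hasStop⇔containsStop r))
    where
    r : Vec (Fin k) n
    r = fromBounded w b
    c′ : Covers k (map toℕ r)
    c′ = subst (Covers k) (sym (map-toℕ-fromBounded w b)) c
    s′ : StopFree (map toℕ r)
    s′ = subst StopFree (sym (map-toℕ-fromBounded w b)) s
  to∘from : ∀ a → to (from a) ≡ a
  to∘from (k , w , b , _) = ActiveWord-≡ (map-toℕ-fromBounded w b)
  from∘to : ∀ a → from (to a) ≡ a
  from∘to (k , r , _) = Active-≡ (fromBounded-map-toℕ r _)
    where
    Active-≡ : ∀ {k} {r r′ : Vec (Fin k) n} {p p′} → r ≡ r′ → _≡_ {A = Active n} (k , r , p) (k , r′ , p′)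
    Active-≡ {k} {r} refl = cong (λ p → k , r , p) (cong₂ _,_ (T-irrelevant _ _) (T-irrelevant _ _))

proposition8 : (n : ℕ) → (Active n ↔ MarkedDyck n) × (Active n ↔ Fin (littleSchroeder n))
proposition8 n = ↔-trans active↔markedForest (↔-sym (markedDyck↔markedForest n)) ,
                 ↔-trans active↔markedForest (markedForest↔Fin n)
  where
  active↔markedForest : Active n ↔ MarkedForest n
  active↔markedForest = ↔-trans (active↔activeWord n) (schroederGrowth-↔ activeWordGrowth markedForestGrowth n)
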